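{- Consider a normalized instance of \textsc{Constrained Layer Tree}. Let $a$ and $b$ be relaxed partial solutions with $a_0$ and $b_0$ leaves and branching layers $k_a,k_b$, and let $k$ be an integer with $\max\{k_a,k_b\}\le k\le\lambda-1$. Let $c=(c_0,\dots,c_\lambda)$ be the $k$-combination of $a$ and $b$. If $c_i\le n_i$ for every $i\in\{0,\dots,\lambda\}$, $c_0\le u_{k+1}$, $a_0\ge\ell_k$ and $b_0\ge\ell_k$, then $c$ is a relaxed partial solution with $a_0+b_0$ leaves.
   Context: A layer tree with layers $0,\dots,\lambda$ is a rooted tree whose leaves are in layer $0$, with exactly one root in layer $\lambda$, every edge going from a vertex in layer $i-1$ to its parent in layer $i$. The weight $w(v)$ of a vertex is the number of leaves in its subtree. An instance of \textsc{Constrained Layer Tree} is given by nonnegative integers $n_0$ and $(n_i,\ell_i,u_i)_{i\in\{1,\dots,\lambda\}}$, with the convention $\ell_0=u_0=1$. The instance is normalized if $n_i\le n_{i-1}$, $\ell_i\ge\ell_{i-1}$, $u_i\ge u_{i-1}$ for all $i\in\{1,\dots,\lambda\}$. The branching layer of a layer tree (or of a vector $a\in\mathbb N^{\lambda+1}$) is the highest layer $i$ with more than one vertex (resp. $a_i>1$), and $0$ if no such layer exists. A layer tree with branching layer $k$ is almost valid if it has at most $n_i$ vertices in each layer $i$, every vertex $v$ in a layer $i\in\{1,\dots,k\}$ satisfies $\ell_i\le w(v)\le u_i$, and the number of leaves is at most $u_i$ for each $i\in\{k+1,\dots,\lambda\}$. A vector $a=(a_0,\dots,a_\lambda)$ is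 a relaxed partial solution (with $a_0$ leaves) if there is an almost valid layer tree with exactly $a_i$ vertices in layer $i$ for each $i$. For such vectors $a,b$ with branching layers $k_a,k_b$ and $k\in\{\max\{k_a,k_b\},\dots,\lambda\}$, the $k$-combination of $a$ and $b$ is $(a_0+b_0,\dots,a_k+b_k,1,\dots,1)$. -}

module Defs where

open import Data.Nat using (ℕ; zero; suc; _+_; _≤_; _<_; _<ᵇ_; _≡ᵇ_)
open import Data.Bool using (if_then_else_)
open import Data.Product using (Σ; _×_)
open import Relation.Binary.PropositionalEquality using (_≡_)

-- Layer trees: LTree i is a (sub)tree whose root lies in layer i.
-- Leaves are exactly the vertices of layer 0; every vertex in layer
-- suc i has a nonempty forest of children in layer i.
mutual
  data LTree : ℕ → Set where
    leaf : LTree zero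
    node : ∀ {i} → Forest i → LTree (suc i)

  data Forest (i : ℕ) : Set where
    one  : LTree i → Forest i
    cons : LTree i → Forest i → Forest i

mutual
  leaves : ∀ {i} → LTree i → ℕ
  leaves leaf     = 1
  leaves (node f) = leavesF f

  leavesF : ∀ {i} → Forest i → ℕ
  leavesF (one t)    = leaves t
  leavesF (cons t f) = leaves t + leavesF f

mutual
  count : ∀ {i} → ℕ → LTree i → ℕ
  count j leaf             = if j ≡ᵇ 0 then 1 else 0
  count j (node {i} f)     = (if j ≡ᵇ suc i then 1 else 0) + countF j f

  countF : ∀ {i} → ℕ → Forest i → ℕ
  countF j (one t)    = count j t
  countF j (cons t f) = count j t + countF j f

mutual
  Every : (∀ {i} → LTree i → Set) → ∀ {i} → LTree i → Set
  Every P leaf     = P leaf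
  Every P (node f) = P (node f) × EveryF P f

  EveryF : (∀ {i} → LTree i → Set) → ∀ {i} → Forest i → Set
  EveryF P (one t)    = Every P t
  EveryF P (cons t f) = Every P t × EveryF P f

branchV : (ℕ → ℕ) → ℕ → ℕ
branchV a zero    = 0
branchV a (suc j) = if 1 <ᵇ a (suc j) then suc j else branchV a j

branchT : ∀ {Λ} → LTree Λ → ℕ
branchT {Λ} t = branchV (λ j → count j t) Λ

-- Instance of Constrained Layer Tree: Λ (= λ), n_0..n_Λ, ℓ_1..ℓ_Λ, u_1..u_Λ,
-- with the convention ℓ 0 = u 0 = 1.  Values at indices > Λ are irrelevant.
record Instance : Set where
  field
    Λ  : ℕ
    n  : ℕ → ℕ
    ℓ  : ℕ → ℕ
    u  : ℕ → ℕ
    ℓ0 : ℓ 0 ≡ 1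
    u0 : u 0 ≡ 1

module _ (I : Instance) where
  open Instance I

  Normalized : Set
  Normalized = ∀ i → suc i ≤ Λ →
    (n (suc i) ≤ n i) × (ℓ i ≤ ℓ (suc i)) × (u i ≤ u (suc i))

  AlmostValid : LTree Λ → Set
  AlmostValid t =
    (∀ i → i ≤ Λ → count i t ≤ n i)
    × Every (λ {i} s → 1 ≤ i → i ≤ branchT t → (ℓ i ≤ leaves s) × (leaves s ≤ u i)) t
    × (∀ i → branchT t < i → i ≤ Λ → leaves t ≤ u i)

  RelaxedPartialSolution : (ℕ → ℕ) → Set
  RelaxedPartialSolution a =
    Σ (LTree Λ) λ t → AlmostValid t × (∀ i → i ≤ Λ → count i t ≡ a i)

combination : ℕ → (ℕ → ℕ) → (ℕ → ℕ) → (ℕ → ℕ)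
combination k a b i = if i <ᵇ suc k then a i + b i else 1

{-# OPTIONS --safe #-}
-- Cut both trees at layer k: concatenate the forests of their layer-k vertices and put a chain
-- of unary vertices on top. The new tree has a_i + b_i vertices in each layer i ≤ k and one in
-- each layer above, so its branching layer is k. Its vertices in layers 1..k inherit the bounds
-- ℓ_i ≤ w(v) ≤ u_i: up to the branching layer of the old tree they are part of almost validity,
-- and above it a layer has a single vertex, which carries all a_0 leaves, so that
-- ℓ_i ≤ ℓ_k ≤ a_0 ≤ u_i. Above layer k the tree has a_0 + b_0 ≤ u_{k+1} ≤ u_i leaves.
module Submission where

open import Defs
open import Data.Nat using (ℕ; zero; suc; _+_; _≤_; _<_; _⊔_; _≤′_; _<′_; ≤′-refl; ≤′-step; z≤n; s≤s; _<ᵇ_)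
open import Data.Nat.Properties
open import Data.Bool using (T; true; false)
open import Data.Product using (_×_; _,_; proj₁; proj₂)
open import Data.Sum using (inj₁; inj₂)
open import Relation.Nullary using (yes; no; contradiction)
open import Relation.Nullary.Decidable using (dec-true; dec-false)
open import Relation.Binary.PropositionalEquality

private variable
  i j k m : ℕ
  P Q R : ∀ {i} → LTree i → Set

mutual
  Every-zipWith : (∀ {i} (s : LTree i) → P s → Q s → R s) →
    (t : LTree j) → Every P t → Every Q t → Every R t
  Every-zipWith h leaf     p        q        = h leaf p q
  Every-zipWith h (node f) (p , ps) (q , qs) = h (node f) p q , EveryF-zipWith h f ps qs

  EveryF-zipWith : (∀ {i} (s : LTree i) → P s → Q s → R s) →
    (f : Forest j) → EveryF P f → EveryF Q f → EveryF R f
  EveryF-zipWith h (one t)    ps       qs       = Every-zipWith h t ps qs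
  EveryF-zipWith h (cons t f) (p , ps) (q , qs) = Every-zipWith h t p q , EveryF-zipWith h f ps qs

EveryF-map : (∀ {i} (s : LTree i) → P s → Q s) → (f : Forest j) → EveryF P f → EveryF Q f
EveryF-map {P = P} h f e = EveryF-zipWith {P = P} {Q = P} (λ s p _ → h s p) f e e

mutual
  Every-below : (t : LTree j) → j ≤ m → Every (λ {i} _ → i ≤ m) t
  Every-below leaf     _   = z≤n
  Every-below (node f) j≤m = j≤m , EveryF-below f (<⇒≤ j≤m)

  EveryF-below : (f : Forest j) → j ≤ m → EveryF (λ {i} _ → i ≤ m) f
  EveryF-below (one t)    j≤m = Every-below t j≤m
  EveryF-below (cons t f) j≤m = Every-below t j≤m , EveryF-below f j≤m

count-node-≢ : (f : Forest j) → i ≢ suc j → count i (node f) ≡ countF i f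
count-node-≢ {j} {i} f i≢1+j rewrite dec-false (i ≟ suc j) i≢1+j = refl

count-node-≤ : (f : Forest j) → i ≤ j → count i (node f) ≡ countF i f
count-node-≤ f i≤j = count-node-≢ f (λ i≡1+j → <-irrefl i≡1+j (s≤s i≤j))

mutual
  count-above : (t : LTree j) → j < i → count i t ≡ 0
  count-above {i = suc i} leaf _ = refl
  count-above (node f) j<i =
    trans (count-node-≢ f (λ i≡j → <-irrefl (sym i≡j) j<i)) (countF-above f (<-trans (n<1+n _) j<i))

  countF-above : (f : Forest j) → j < i → countF i f ≡ 0
  countF-above (one t)    j<i = count-above t j<i
  countF-above (cons t f) j<i = cong₂ _+_ (count-above t j<i) (countF-above f j<i)

count-node-top : (f : Forest j) → count (suc j) (node f) ≡ 1
count-node-top {j} f rewrite dec-true (suc j ≟ suc j) refl = cong suc (countF-above f ≤-refl)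

mutual
  count-pos : (t : LTree j) → i ≤ j → 0 < count i t
  count-pos leaf z≤n = s≤s z≤n
  count-pos (node f) i≤1+j with m≤n⇒m<n∨m≡n i≤1+j
  ... | inj₁ (s≤s i≤j) = subst (0 <_) (sym (count-node-≤ f i≤j)) (countF-pos f i≤j)
  ... | inj₂ refl      = subst (0 <_) (sym (count-node-top f)) (s≤s z≤n)

  countF-pos : (f : Forest j) → i ≤ j → 0 < countF i f
  countF-pos (one t)    i≤j = count-pos t i≤j
  countF-pos (cons t f) i≤j = ≤-trans (count-pos t i≤j) (m≤m+n _ _)

mutual
  count₀≡leaves : (t : LTree j) → count 0 t ≡ leaves t
  count₀≡leaves leaf     = refl
  count₀≡leaves (node f) = countF₀≡leavesF f

  countF₀≡leavesF : (f : Forest j) → countF 0 f ≡ leavesF f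
  countF₀≡leavesF (one t)    = count₀≡leaves t
  countF₀≡leavesF (cons t f) = cong₂ _+_ (count₀≡leaves t) (countF₀≡leavesF f)

leaves≡count₀ : {a : ℕ → ℕ} (t : LTree m) → (∀ i → i ≤ m → count i t ≡ a i) → leaves t ≡ a 0
leaves≡count₀ t count-t = trans (sym (count₀≡leaves t)) (count-t 0 z≤n)

lone-vertex-leaves : (t : LTree j) → Every (λ {i} s → count i t ≤ 1 → leaves s ≡ leaves t) t
lone-vertex-leaves leaf     = λ _ → refl
lone-vertex-leaves (node f) = (λ _ → refl) , children f
  where
  children : (f : Forest j) → EveryF (λ {i} s → count i (node f) ≤ 1 → leaves s ≡ leavesF f) f
  children (one t) = Every-zipWith transfer t (Every-below t ≤-refl) (lone-vertex-leaves t)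
    where
    transfer : ∀ {i} (s : LTree i) → i ≤ _ → (count i t ≤ 1 → leaves s ≡ leaves t) →
      count i (node (one t)) ≤ 1 → leaves s ≡ leaves t
    transfer {i} _ i≤j lone alone = lone (subst (_≤ 1) (count-node-≤ (one t) i≤j) alone)
  children (cons t f) = EveryF-map crowded (cons t f) (EveryF-below (cons t f) ≤-refl)
    where
    crowded : ∀ {i} (s : LTree i) → i ≤ _ →
      count i (node (cons t f)) ≤ 1 → leaves s ≡ leaves t + leavesF f
    crowded {i} _ i≤j alone = contradiction
      (subst (_≤ 1) (count-node-≤ (cons t f) i≤j) alone)
      (<⇒≱ (+-mono-≤ (count-pos t i≤j) (countF-pos f i≤j)))

infixr 5 _++F_

_++F_ : Forest j → Forest j → Forest j
one t    ++F g = cons t g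
cons t f ++F g = cons t (f ++F g)

countF-++ : ∀ i (f g : Forest j) → countF i (f ++F g) ≡ countF i f + countF i g
countF-++ i (one t)    g = refl
countF-++ i (cons t f) g =
  trans (cong (count i t +_) (countF-++ i f g)) (sym (+-assoc (count i t) _ _))

EveryF-++ : (f : Forest j) {g : Forest j} → EveryF P f → EveryF P g → EveryF P (f ++F g)
EveryF-++ (one t)    p        ps = p , ps
EveryF-++ (cons t f) (p , ps) qs = p , EveryF-++ f ps qs

mutual
  forestAt : k <′ m → LTree m → Forest k
  forestAt ≤′-refl       (node f) = f
  forestAt (≤′-step k<m) (node f) = forestAtF k<m f

  forestAtF : k <′ m → Forest m → Forest k
  forestAtF k<m (one t)    = forestAt k<m t
  forestAtF k<m (cons t f) = forestAt k<m t ++F forestAtF k<m f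

mutual
  countF-forestAt : (k<m : k <′ m) (t : LTree m) → i ≤ k → countF i (forestAt k<m t) ≡ count i t
  countF-forestAt ≤′-refl       (node f) i≤k = sym (count-node-≤ f i≤k)
  countF-forestAt (≤′-step k<m) (node f) i≤k =
    trans (countF-forestAtF k<m f i≤k) (sym (count-node-≤ f (≤-trans i≤k (<⇒≤ (≤′⇒≤ k<m)))))

  countF-forestAtF : (k<m : k <′ m) (f : Forest m) → i ≤ k → countF i (forestAtF k<m f) ≡ countF i f
  countF-forestAtF k<m (one t)    i≤k = countF-forestAt k<m t i≤k
  countF-forestAtF {i = i} k<m (cons t f) i≤k =
    trans (countF-++ i (forestAt k<m t) _)
          (cong₂ _+_ (countF-forestAt k<m t i≤k) (countF-forestAtF k<m f i≤k))

mutual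
  EveryF-forestAt : (k<m : k <′ m) (t : LTree m) → Every P t → EveryF P (forestAt k<m t)
  EveryF-forestAt ≤′-refl       (node f) (_ , ps) = ps
  EveryF-forestAt (≤′-step k<m) (node f) (_ , ps) = EveryF-forestAtF k<m f ps

  EveryF-forestAtF : (k<m : k <′ m) (f : Forest m) → EveryF P f → EveryF P (forestAtF k<m f)
  EveryF-forestAtF k<m (one t)    ps       = EveryF-forestAt k<m t ps
  EveryF-forestAtF k<m (cons t f) (p , ps) =
    EveryF-++ (forestAt k<m t) (EveryF-forestAt k<m t p) (EveryF-forestAtF k<m f ps)

graft : k <′ m → Forest k → LTree m
graft ≤′-refl       f = node f
graft (≤′-step k<m) f = node (one (graft k<m f))

count-graft-≤ : (k<m : k <′ m) (f : Forest k) → i ≤ k → count i (graft k<m f) ≡ countF i f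
count-graft-≤ ≤′-refl       f i≤k = count-node-≤ f i≤k
count-graft-≤ (≤′-step k<m) f i≤k =
  trans (count-node-≤ (one (graft k<m f)) (≤-trans i≤k (<⇒≤ (≤′⇒≤ k<m)))) (count-graft-≤ k<m f i≤k)

count-graft-> : (k<m : k <′ m) (f : Forest k) → k < i → i ≤ m → count i (graft k<m f) ≡ 1
count-graft-> ≤′-refl f k<i i≤1+k
  rewrite ≤-antisym i≤1+k k<i = count-node-top f
count-graft-> (≤′-step k<m) f k<i i≤1+m with m≤n⇒m<n∨m≡n i≤1+m
... | inj₁ (s≤s i≤m) = trans (count-node-≤ (one (graft k<m f)) i≤m) (count-graft-> k<m f k<i i≤m)
... | inj₂ refl      = count-node-top (one (graft k<m f))

Every-graft : (k<m : k <′ m) (f : Forest k) →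
  (∀ {i} (s : LTree i) → k < i → P s) → EveryF P f → Every P (graft k<m f)
Every-graft ≤′-refl       f above ps = above (node f) ≤-refl , ps
Every-graft (≤′-step k<m) f above ps =
  above (node (one (graft k<m f))) (m≤n⇒m≤1+n (≤′⇒≤ k<m)) , Every-graft k<m f above ps

combine : k < m → LTree m → LTree m → LTree m
combine k<m ta tb = graft (<⇒<′ k<m) (forestAt (<⇒<′ k<m) ta ++F forestAt (<⇒<′ k<m) tb)

count-combine-≤ : (k<m : k < m) (ta tb : LTree m) → i ≤ k →
  count i (combine k<m ta tb) ≡ count i ta + count i tb
count-combine-≤ {k = k} {m = m} {i = i} k<m ta tb i≤k = begin
  count i (graft k<m′ (forestAt k<m′ ta ++F forestAt k<m′ tb))     ≡⟨ count-graft-≤ k<m′ _ i≤k ⟩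
  countF i (forestAt k<m′ ta ++F forestAt k<m′ tb)                 ≡⟨ countF-++ i (forestAt k<m′ ta) _ ⟩
  countF i (forestAt k<m′ ta) + countF i (forestAt k<m′ tb)        ≡⟨ cong₂ _+_ (countF-forestAt k<m′ ta i≤k)
                                                                                (countF-forestAt k<m′ tb i≤k) ⟩
  count i ta + count i tb                                          ∎
  where
  open ≡-Reasoning
  k<m′ : k <′ m
  k<m′ = <⇒<′ k<m

count-combine-> : (k<m : k < m) (ta tb : LTree m) → k < i → i ≤ m → count i (combine k<m ta tb) ≡ 1
count-combine-> k<m ta tb = count-graft-> (<⇒<′ k<m) _

Every-combine : (k<m : k < m) (ta tb : LTree m) → (∀ {i} (s : LTree i) → k < i → P s) →
  Every P ta → Every P tb → Every P (combine k<m ta tb)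
Every-combine {k = k} {m = m} k<m ta tb above pa pb = Every-graft k<m′ _ above
  (EveryF-++ (forestAt k<m′ ta) (EveryF-forestAt k<m′ ta pa) (EveryF-forestAt k<m′ tb pb))
  where
  k<m′ : k <′ m
  k<m′ = <⇒<′ k<m

branchV-cong : ∀ {a b} Λ → (∀ i → i ≤ Λ → a i ≡ b i) → branchV a Λ ≡ branchV b Λ
branchV-cong zero    _   = refl
branchV-cong {a} {b} (suc Λ) a≗b
  rewrite a≗b (suc Λ) ≤-refl | branchV-cong {a} {b} Λ (λ i i≤Λ → a≗b i (m≤n⇒m≤1+n i≤Λ)) = refl

branchV-above : ∀ a Λ → branchV a Λ < i → i ≤ Λ → a i ≤ 1
branchV-above a zero (s≤s _) ()
branchV-above a (suc Λ) b<i i≤1+Λ with 1 <ᵇ a (suc Λ) in 1<ᵇa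
... | true = contradiction (<-≤-trans b<i i≤1+Λ) (<-irrefl refl)
... | false with m≤n⇒m<n∨m≡n i≤1+Λ
...   | inj₁ (s≤s i≤Λ) = branchV-above a Λ b<i i≤Λ
...   | inj₂ refl      = ≮⇒≥ (λ 1<a → subst T 1<ᵇa (<⇒<ᵇ 1<a))

branchV-≡ : ∀ c Λ → k ≤ Λ → 2 ≤ c k → (∀ i → k < i → i ≤ Λ → c i ≡ 1) → branchV c Λ ≡ k
branchV-≡ c zero z≤n _ _ = refl
branchV-≡ c (suc Λ) k≤1+Λ 2≤ck above with m≤n⇒m<n∨m≡n k≤1+Λ
... | inj₂ refl rewrite dec-true (1 <? c (suc Λ)) 2≤ck = refl
... | inj₁ (s≤s k≤Λ) rewrite above (suc Λ) (s≤s k≤Λ) ≤-refl =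
  branchV-≡ c Λ k≤Λ 2≤ck (λ i k<i i≤Λ → above i k<i (m≤n⇒m≤1+n i≤Λ))

combination-≤ : ∀ a b → i ≤ k → combination k a b i ≡ a i + b i
combination-≤ {i} {k} a b i≤k rewrite dec-true (i <? suc k) (s≤s i≤k) = refl

combination-> : ∀ a b → k < i → combination k a b i ≡ 1
combination-> {k} {i} a b k<i rewrite dec-false (i <? suc k) (≤⇒≯ k<i) = refl

count-combine : {a b : ℕ → ℕ} (k<m : k < m) (ta tb : LTree m) →
  (∀ i → i ≤ m → count i ta ≡ a i) → (∀ i → i ≤ m → count i tb ≡ b i) →
  ∀ i → i ≤ m → count i (combine k<m ta tb) ≡ combination k a b i
count-combine {k = k} {a = a} {b} k<m ta tb count-a count-b i i≤m with i ≤? k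
... | yes i≤k = begin
  count i (combine k<m ta tb) ≡⟨ count-combine-≤ k<m ta tb i≤k ⟩
  count i ta + count i tb     ≡⟨ cong₂ _+_ (count-a i i≤m) (count-b i i≤m) ⟩
  a i + b i                   ≡⟨ combination-≤ a b i≤k ⟨
  combination k a b i         ∎
  where open ≡-Reasoning
... | no  i≰k = trans (count-combine-> k<m ta tb (≰⇒> i≰k) i≤m) (sym (combination-> a b (≰⇒> i≰k)))

branchT-combine : (k<m : k < m) (ta tb : LTree m) → branchT (combine k<m ta tb) ≡ k
branchT-combine {m = m} k<m ta tb = branchV-≡ (λ i → count i (combine k<m ta tb)) m (<⇒≤ k<m)
  (subst (2 ≤_) (sym (count-combine-≤ k<m ta tb ≤-refl))
    (+-mono-≤ (count-pos ta (<⇒≤ k<m)) (count-pos tb (<⇒≤ k<m))))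
  (λ i k<i i≤m → count-combine-> k<m ta tb k<i i≤m)

mono-from-suc : ∀ (f : ℕ → ℕ) n → (∀ i → suc i ≤ n → f i ≤ f (suc i)) → i ≤ j → j ≤ n → f i ≤ f j
mono-from-suc f n step i≤j j≤n = go (≤⇒≤′ i≤j) j≤n
  where
  go : ∀ {i j} → i ≤′ j → j ≤ n → f i ≤ f j
  go ≤′-refl        _   = ≤-refl
  go (≤′-step i≤j) j≤n = ≤-trans (go i≤j (<⇒≤ j≤n)) (step _ j≤n)

module _ (I : Instance) where
  open Instance I

  Bounded : ℕ → ∀ {i} → LTree i → Set
  Bounded k {i} s = 1 ≤ i → i ≤ k → (ℓ i ≤ leaves s) × (leaves s ≤ u i)

  module _ (norm : Normalized I) where

    ℓ-mono : i ≤ j → j ≤ Λ → ℓ i ≤ ℓ j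
    ℓ-mono = mono-from-suc ℓ Λ (λ i 1+i≤Λ → proj₁ (proj₂ (norm i 1+i≤Λ)))

    u-mono : i ≤ j → j ≤ Λ → u i ≤ u j
    u-mono = mono-from-suc u Λ (λ i 1+i≤Λ → proj₂ (proj₂ (norm i 1+i≤Λ)))

    Every-Bounded : (t : LTree Λ) → AlmostValid I t → k < Λ → ℓ k ≤ leaves t → Every (Bounded k) t
    Every-Bounded {k} t (_ , bounded , top) k<Λ ℓk≤t = Every-zipWith widen t bounded (lone-vertex-leaves t)
      where
      widen : ∀ {i} (s : LTree i) → Bounded (branchT t) s → (count i t ≤ 1 → leaves s ≡ leaves t) →
        Bounded k s
      widen {i} s below lone 1≤i i≤k with i ≤? branchT t
      ... | yes i≤b = below 1≤i i≤b
      ... | no  i≰b = subst (ℓ i ≤_) (sym s≡t) (≤-trans (ℓ-mono i≤k (<⇒≤ k<Λ)) ℓk≤t)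
                    , subst (_≤ u i) (sym s≡t) (top i (≰⇒> i≰b) i≤Λ)
        where
        i≤Λ : i ≤ Λ
        i≤Λ = ≤-trans i≤k (<⇒≤ k<Λ)
        s≡t : leaves s ≡ leaves t
        s≡t = lone (branchV-above (λ j → count j t) Λ (≰⇒> i≰b) i≤Λ)

lemma3p4 : (I : Instance) → Normalized I →
    (a b : ℕ → ℕ) → RelaxedPartialSolution I a → RelaxedPartialSolution I b →
    (k : ℕ) →
    branchV a (Instance.Λ I) ⊔ branchV b (Instance.Λ I) ≤ k →
    k + 1 ≤ Instance.Λ I →
    (∀ i → i ≤ Instance.Λ I → combination k a b i ≤ Instance.n I i) →
    combination k a b 0 ≤ Instance.u I (suc k) →
    Instance.ℓ I k ≤ a 0 →
    Instance.ℓ I k ≤ b 0 →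
    RelaxedPartialSolution I (combination k a b)
lemma3p4 I norm a b (ta , valid-a , count-a) (tb , valid-b , count-b) k _ k+1≤Λ c≤n c₀≤u ℓ≤a₀ ℓ≤b₀ =
  t , (c≤n-t , bounded-t , top-t) , count-t
  where
  open Instance I
  k<Λ : k < Λ
  k<Λ = subst (_≤ Λ) (+-comm k 1) k+1≤Λ
  t : LTree Λ
  t = combine k<Λ ta tb
  count-t : ∀ i → i ≤ Λ → count i t ≡ combination k a b i
  count-t = count-combine k<Λ ta tb count-a count-b
  c≤n-t : ∀ i → i ≤ Λ → count i t ≤ n i
  c≤n-t i i≤Λ = subst (_≤ n i) (sym (count-t i i≤Λ)) (c≤n i i≤Λ)
  bounded-t : Every (Bounded I (branchT t)) t
  bounded-t = subst (λ b → Every (Bounded I b) t) (sym (branchT-combine k<Λ ta tb))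
    (Every-combine k<Λ ta tb (λ s k<i _ i≤k → contradiction i≤k (<⇒≱ k<i))
      (Every-Bounded I norm ta valid-a k<Λ (subst (ℓ k ≤_) (sym (leaves≡count₀ ta count-a)) ℓ≤a₀))
      (Every-Bounded I norm tb valid-b k<Λ (subst (ℓ k ≤_) (sym (leaves≡count₀ tb count-b)) ℓ≤b₀)))
  top-t : ∀ i → branchT t < i → i ≤ Λ → leaves t ≤ u i
  top-t i b<i i≤Λ = subst (_≤ u i) (sym (leaves≡count₀ t count-t))
    (≤-trans c₀≤u (u-mono I norm (subst (_< i) (branchT-combine k<Λ ta tb) b<i) i≤Λ))
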